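{- Let $G$ be a Nim sequence with seed $[g_0,\dots,g_{L-1}]$ over an additively periodic sequence $(\mathcal{Y}_x)_{x\in\mathbb{N}}$ of finite subsets of $\mathbb{Z}$ with lower difference bound $M^-$, and let $d(x)=G(x)-x$. Then there exists $C\in\mathbb{N}$ with $C\le\max_{x<L}g_x+1$ such that $d(x)\ge\min(0,M^-)$ for all $x\ge C$.
   Context: $\mathbb{N}=\{0,1,2,\dots\}$. For a finite $Y\subseteq\mathbb{Z}$, $\operatorname{mex}(Y)=\min(\mathbb{N}\setminus Y)$. $(\mathcal{Y}_x)$ is additively periodic if there is $p\ge1$ with $\mathcal{Y}_{x+p}=\mathcal{Y}_x+p$ for all $x\in\mathbb{N}$. $M^-=\min\{z-x: x\in\mathbb{N}, z\in\mathcal{Y}_x\}-1$. A Nim sequence over $(\mathcal{Y}_x)$ with seed $[g_0,\dots,g_{L-1}]$ ($L\in\mathbb{N}$, $g_i\in\mathbb{N}$ pairwise distinct) is $G:\mathbb{N}\to\mathbb{N}$ with $G(x)=g_x$ for $x<L$ and $G(x)=\operatorname{mex}(\{G(x'):x'<x\}\cup\mathcal{Y}_x)$ for $x\ge L$. -}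

module Defs where

open import Data.Nat as ℕ using (ℕ; _<_; _≤_; _≥_; _⊔_)
open import Data.Integer as ℤ using (ℤ; +_; _-_)
open import Data.List using (List; length; lookup; foldr)
open import Data.List.Membership.Propositional using (_∈_)
open import Data.List.Relation.Unary.Unique.Propositional using (Unique)
open import Data.Fin using (fromℕ<)
open import Data.Product using (Σ; _×_; ∃; ∃-syntax)
open import Data.Sum using (_⊎_)
open import Relation.Binary.PropositionalEquality using (_≡_)
open import Relation.Nullary using (¬_)
open import Function.Bundles using (_⇔_)

ZSeq : Set
ZSeq = ℕ → List ℤ

AdditivelyPeriodic : ZSeq → Set
AdditivelyPeriodic Y =
  ∃[ p ] (1 ≤ p × (∀ x (z : ℤ) → (z ∈ Y (x ℕ.+ p)) ⇔ ((z - + p) ∈ Y x)))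

IsLowerDiffBound : ZSeq → ℤ → Set
IsLowerDiffBound Y M =
  (∀ x z → z ∈ Y x → M ℤ.+ + 1 ℤ.≤ z - + x)
  × (∃[ x ] ∃[ z ] (z ∈ Y x × z - + x ≡ M ℤ.+ + 1))

IsMex : (ℤ → Set) → ℕ → Set
IsMex S m = ¬ S (+ m) × (∀ k → k < m → S (+ k))

IsNimSequence : ZSeq → List ℕ → (ℕ → ℕ) → Set
IsNimSequence Y g G =
  Unique g
  × (∀ x → (x<L : x < length g) → G x ≡ lookup g (fromℕ< x<L))
  × (∀ x → x ≥ length g →
       IsMex (λ n → (∃[ x' ] (x' < x × n ≡ + G x')) ⊎ (n ∈ Y x)) (G x))

-- max_{x<L} g_x (with the convention max ∅ = 0).
maxSeed : List ℕ → ℕ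
maxSeed = foldr _⊔_ 0

module Submission where

-- With c = -min(0, M⁻), no natural number k with k + c ≤ x lies in Y_x, so past
-- the seed G x is the least value k with k + c < x not taken earlier, if one
-- exists; and once every such value is taken, this persists. Hence a violation
-- G x + c < x at some x > maxSeed g forces G y + c < y for all seedless y ≤ x,
-- so G sends 0, …, maxSeed g + 1 injectively into 0, …, maxSeed g.

open import Defs
open import Data.Nat using (ℕ; _≤_; _≥_)
open import Data.Integer using (ℤ; +_; _-_; _⊓_)
open import Data.List using (List)
open import Data.Product using (∃; ∃-syntax; _×_)

open import Data.Nat as N using (suc; _<_; _≤′_; ≤′-refl; ≤′-step; _≤?_; _<?_; s≤s)
import Data.Nat.Properties as NP
open import Data.Integer as Z using (-[1+_]; -_)
import Data.Integer.Properties as ZP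
open import Data.Integer.Solver using (module +-*-Solver)
open import Data.List using (_∷_; length; lookup)
open import Data.List.Membership.Propositional using (_∈_)
open import Data.List.Membership.Propositional.Properties using (∈-lookup)
import Data.List.Relation.Unary.All as All
open import Data.List.Relation.Unary.AllPairs using (_∷_)
open import Data.List.Relation.Unary.Unique.Propositional using (Unique)
open import Data.Fin as F using (Fin; toℕ; fromℕ<)
import Data.Fin.Properties as FP
open import Data.Product using (_,_; proj₁; proj₂)
open import Data.Sum using (inj₁; inj₂)
open import Data.Empty using (⊥-elim)
open import Function using (_∘_)
open import Relation.Nullary using (¬_; yes; no)
open import Relation.Binary.Definitions using (tri<; tri≈; tri>)
open import Relation.Binary.PropositionalEquality

0⊓-as-neg : ∀ M → ∃[ c ] (+ 0 ⊓ M ≡ - + c × - + c Z.≤ M)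
0⊓-as-neg (+ n)    = 0 , refl , Z.+≤+ N.z≤n
0⊓-as-neg -[1+ n ] = suc n , refl , ZP.≤-refl

1-c≤a-b⇒b<a+c : ∀ a b c → (- + c) Z.+ + 1 Z.≤ + a - + b → b < a N.+ c
1-c≤a-b⇒b<a+c a b c h = ZP.drop‿+≤+ (subst₂ Z._≤_ (lhs (+ b) (+ c)) (rhs (+ a) (+ b) (+ c))
                                        (ZP.+-monoˡ-≤ (+ b Z.+ + c) h))
  where
  open +-*-Solver
  lhs : ∀ b c → ((- c) Z.+ + 1) Z.+ (b Z.+ c) ≡ + 1 Z.+ b
  lhs = solve 2 (λ b c → ((:- c) :+ con (+ 1)) :+ (b :+ c) := con (+ 1) :+ b) refl
  rhs : ∀ a b c → (a - b) Z.+ (b Z.+ c) ≡ a Z.+ c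
  rhs = solve 3 (λ a b c → (a :- b) :+ (b :+ c) := a :+ c) refl

b≤a+c⇒-c≤a-b : ∀ a b c → b ≤ a N.+ c → - + c Z.≤ + a - + b
b≤a+c⇒-c≤a-b a b c h = subst₂ Z._≤_ (lhs (+ b) (+ c)) (rhs (+ a) (+ b) (+ c))
                         (ZP.+-monoˡ-≤ (- + c - + b) (Z.+≤+ h))
  where
  open +-*-Solver
  lhs : ∀ b c → b Z.+ (- c - b) ≡ - c
  lhs = solve 2 (λ b c → b :+ (:- c :- b) := :- c) refl
  rhs : ∀ a b c → (a Z.+ c) Z.+ (- c - b) ≡ a - b
  rhs = solve 3 (λ a b c → (a :+ c) :+ (:- c :- b) := a :- b) refl

lookup≤maxSeed : ∀ (g : List ℕ) (i : Fin (length g)) → lookup g i ≤ maxSeed g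
lookup≤maxSeed (a ∷ g) F.zero    = NP.m≤m⊔n a _
lookup≤maxSeed (a ∷ g) (F.suc i) = NP.≤-trans (lookup≤maxSeed g i) (NP.m≤n⊔m a _)

lookup-injective : ∀ (g : List ℕ) → Unique g →
                   ∀ i j → lookup g i ≡ lookup g j → i ≡ j
lookup-injective (a ∷ g) u       F.zero    F.zero    e = refl
lookup-injective (a ∷ g) (h ∷ u) F.zero    (F.suc j) e = ⊥-elim (All.lookup h (∈-lookup {xs = g} j) e)
lookup-injective (a ∷ g) (h ∷ u) (F.suc i) F.zero    e = ⊥-elim (All.lookup h (∈-lookup {xs = g} i) (sym e))
lookup-injective (a ∷ g) (h ∷ u) (F.suc i) (F.suc j) e = cong F.suc (lookup-injective g u i j e)

pigeonhole-ℕ : ∀ n (f : ℕ → ℕ) → (∀ y → y ≤ n → f y < n) →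
             ∃[ i ] ∃[ j ] (i < j × f i ≡ f j)
pigeonhole-ℕ n f f<n with FP.pigeonhole (NP.n<1+n n) f′
  where f′ : Fin (suc n) → Fin n
        f′ t = fromℕ< (f<n (toℕ t) (NP.m<1+n⇒m≤n (FP.toℕ<n t)))
... | i , j , i<j , e = toℕ i , toℕ j , i<j ,
      trans (sym (FP.toℕ-fromℕ< _)) (trans (cong toℕ e) (FP.toℕ-fromℕ< _))

module _ {Y : ZSeq} {g : List ℕ} {G : ℕ → ℕ} (nim : IsNimSequence Y g G) where

  private
    L = length g

  seed≤maxSeed : ∀ {x} → x < L → G x ≤ maxSeed g
  seed≤maxSeed x<L = subst (_≤ maxSeed g) (sym (proj₁ (proj₂ nim) _ x<L)) (lookup≤maxSeed g _)

  nim-injective : ∀ {x y} → x < y → G x ≢ G y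
  nim-injective {x} {y} x<y e with y <? L
  ... | no y≮L = proj₁ (proj₂ (proj₂ nim) y (NP.≮⇒≥ y≮L)) (inj₁ (x , x<y , cong +_ (sym e)))
  ... | yes y<L = NP.<-irrefl (cong toℕ same-index) toℕ-x<y
    where
    seed = proj₁ (proj₂ nim)
    x<L = NP.<-trans x<y y<L
    same-index : fromℕ< x<L ≡ fromℕ< y<L
    same-index = lookup-injective g (proj₁ nim) _ _ (trans (sym (seed x x<L)) (trans e (seed y y<L)))
    toℕ-x<y : toℕ (fromℕ< x<L) < toℕ (fromℕ< y<L)
    toℕ-x<y = subst₂ _<_ (sym (FP.toℕ-fromℕ< x<L)) (sym (FP.toℕ-fromℕ< y<L)) x<y

NatsAbove : ℕ → ZSeq → Set
NatsAbove c Y = ∀ x k → + k ∈ Y x → x < k N.+ c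

lowerDiffBound⇒natsAbove : ∀ {Y M c} → - + c Z.≤ M →
                           (∀ x z → z ∈ Y x → M Z.+ + 1 Z.≤ z - + x) → NatsAbove c Y
lowerDiffBound⇒natsAbove c≤M bound x k k∈Y =
  1-c≤a-b⇒b<a+c k x _ (ZP.≤-trans (ZP.+-monoˡ-≤ (+ 1) c≤M) (bound x (+ k) k∈Y))

module NimLowerBound {Y : ZSeq} {g : List ℕ} {G : ℕ → ℕ} {c : ℕ}
                     (above : NatsAbove c Y) (nim : IsNimSequence Y g G) where

  private
    L = length g

  Taken : ℕ → ℕ → Set
  Taken x k = ∃[ x′ ] (x′ < x × + k ≡ + G x′)

  Gap : ℕ → Set
  Gap x = ∃[ k ] (k N.+ c < x × ¬ Taken x k)

  taken-suc : ∀ {x k} → Taken x k → Taken (suc x) k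
  taken-suc (x′ , x′<x , e) = x′ , NP.m<n⇒m<1+n x′<x , e

  G-fresh : ∀ {x} → L ≤ x → ¬ Taken x (G x)
  G-fresh L≤x taken = proj₁ (proj₂ (proj₂ nim) _ L≤x) (inj₁ taken)

  taken-below-G : ∀ {x k} → L ≤ x → k < G x → k N.+ c ≤ x → Taken x k
  taken-below-G {x} {k} L≤x k<Gx k+c≤x with proj₂ (proj₂ (proj₂ nim) x L≤x) k k<Gx
  ... | inj₁ taken = taken
  ... | inj₂ k∈Y   = ⊥-elim (NP.<⇒≱ (above x k k∈Y) k+c≤x)

  gap⇒G+c<x : ∀ {x} → L ≤ x → Gap x → G x N.+ c < x
  gap⇒G+c<x {x} L≤x (k , k+c<x , untaken) with G x ≤? k
  ... | yes Gx≤k = NP.≤-<-trans (NP.+-monoˡ-≤ c Gx≤k) k+c<x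
  ... | no Gx≰k  = ⊥-elim (untaken (taken-below-G L≤x (NP.≰⇒> Gx≰k) (NP.<⇒≤ k+c<x)))

  G+c<x⇒gap : ∀ {x} → L ≤ x → G x N.+ c < x → Gap x
  G+c<x⇒gap L≤x G+c<x = _ , G+c<x , G-fresh L≤x

  gap-suc⇒gap : ∀ {x} → L ≤ x → Gap (suc x) → Gap x
  gap-suc⇒gap {x} L≤x (k , k+c<1+x , untaken) with NP.m<1+n⇒m<n∨m≡n k+c<1+x
  ... | inj₁ k+c<x = k , k+c<x , untaken ∘ taken-suc
  ... | inj₂ k+c≡x with NP.<-cmp (G x) k
  ...   | tri< Gx<k _ _ = G+c<x⇒gap L≤x (subst (G x N.+ c <_) k+c≡x (NP.+-monoˡ-< c Gx<k))
  ...   | tri≈ _ Gx≡k _ = ⊥-elim (untaken (x , NP.n<1+n x , cong +_ (sym Gx≡k)))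
  ...   | tri> _ _ k<Gx = ⊥-elim (untaken (taken-suc (taken-below-G L≤x k<Gx (NP.≤-reflexive k+c≡x))))

  gap-downward : ∀ {x y} → L ≤ y → y ≤′ x → Gap x → Gap y
  gap-downward L≤y ≤′-refl          gap = gap
  gap-downward L≤y (≤′-step y≤′x) gap =
    gap-downward L≤y y≤′x (gap-suc⇒gap (NP.≤-trans L≤y (NP.≤′⇒≤ y≤′x)) gap)

  G+c<x⇒G-bounded : ∀ {x} → suc (maxSeed g) ≤ x → G x N.+ c < x →
                    ∀ y → y ≤ suc (maxSeed g) → G y < suc (maxSeed g)
  G+c<x⇒G-bounded s<x G+c<x y y≤s+1 with y <? L
  ... | yes y<L = s≤s (seed≤maxSeed nim y<L)
  ... | no y≮L  = NP.≤-<-trans (NP.m≤m+n (G y) c) (NP.<-≤-trans G+c<y y≤s+1)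
    where
    L≤y = NP.≮⇒≥ y≮L
    y≤x = NP.≤-trans y≤s+1 s<x
    G+c<y = gap⇒G+c<x L≤y (gap-downward L≤y (NP.≤⇒≤′ y≤x) (G+c<x⇒gap (NP.≤-trans L≤y y≤x) G+c<x))

  x≤G+c : ∀ x → suc (maxSeed g) ≤ x → x ≤ G x N.+ c
  x≤G+c x s<x with x ≤? G x N.+ c
  ... | yes x≤G+c = x≤G+c
  ... | no x≰G+c with pigeonhole-ℕ (suc (maxSeed g)) G (G+c<x⇒G-bounded s<x (NP.≰⇒> x≰G+c))
  ...   | i , j , i<j , e = ⊥-elim (nim-injective nim i<j e)

lemmal : (Y : ZSeq) (g : List ℕ) (G : ℕ → ℕ) (M : ℤ) →
    AdditivelyPeriodic Y → IsLowerDiffBound Y M → IsNimSequence Y g G →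
    ∃[ C ] (C ≤ maxSeed g Data.Nat.+ 1 ×
    (∀ x → x ≥ C → (+ 0 ⊓ M) Data.Integer.≤ (+ G x - + x)))
lemmal Y g G M _ (bound , _) nim with 0⊓-as-neg M
... | c , 0⊓M≡-c , -c≤M =
  suc (maxSeed g) , NP.≤-reflexive (NP.+-comm 1 (maxSeed g)) ,
  λ x s<x → subst (Z._≤ + G x - + x) (sym 0⊓M≡-c) (b≤a+c⇒-c≤a-b (G x) x c (x≤G+c x s<x))
  where open NimLowerBound (lowerDiffBound⇒natsAbove -c≤M bound) nim
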